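{- Let $0\le\alpha\le\alpha'<\beta\le\beta'\le m_0$ be such that $[\alpha,\beta]$ and $[\alpha',\beta']$ are free intervals of $w_0$. Then $[\alpha,\beta']$ is a free interval.
   Context: Let $\Gamma_0$ be a finite alphabet with involution $a\mapsto\overline a$ (fixed points allowed), extended to words by $\overline{a_1\cdots a_k}=\overline{a_k}\cdots\overline{a_1}$, and $\Omega_0$ a finite set of variables with fixed-point-free involution. Let $x_1,\dots,x_d\in\Gamma_0\cup\Omega_0$ with $2\le g<d$, and let $\sigma:\Omega_0\to\Gamma_0^*$ with $\sigma(\overline X)=\overline{\sigma(X)}$ (extended to a homomorphism fixing $\Gamma_0$) satisfy $\sigma(x_1\cdots x_g)=\sigma(x_{g+1}\cdots x_d)=:w_0$ and $\sigma(x_i)\ne1$ for all $i$. Let $m_0=|w_0|$. Positions of $w=a_1\cdots a_m$ are $0,\dots,m$; for $0\le\alpha<\beta\le m$ set $w[\alpha,\beta]=a_{\alpha+1}\cdots a_\beta$, $w[\beta,\alpha]=\overline{w[\alpha,\beta]}$, $w[\alpha,\alpha]=1$; an interval is any pair $[\alpha,\beta]$ of positions. For $1\le i\le g$ let $\mathrm{l}(i)=|\sigma(x_1\cdots x_{i-1})|$, for $g<i\le d$ let $\mathrm{l}(i)=|\sigma(x_{g+1}\cdots x_{i-1})|$, and $\mathrm{r}(i)=\mathrm{l}(i)+|\sigma(x_i)|$. The cuts are the positions $\mathrm{l}(i),\mathrm{r}(i)$, $1\le i\le d$. For $i,j$ and $\mu,\nu\in\{0,\dots,\mathrm{r}(i)-\mathrm{l}(i)\}$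 define $[\mathrm{l}(i)+\mu,\mathrm{l}(i)+\nu]\sim[\mathrm{l}(j)+\mu,\mathrm{l}(j)+\nu]$ if $x_i=x_j$, and $[\mathrm{l}(i)+\mu,\mathrm{l}(i)+\nu]\sim[\mathrm{r}(j)-\mu,\mathrm{r}(j)-\nu]$ if $x_i=\overline{x_j}$; let $\approx$ be the reflexive transitive closure of $\sim$. An interval $[\alpha,\beta]$ is free if for every $[\alpha',\beta']\approx[\alpha,\beta]$ there is no cut $\gamma'$ with $\min\{\alpha',\beta'\}<\gamma'<\max\{\alpha',\beta'\}$. -}

module Defs where

open import Data.Nat using (ℕ; _+_; _∸_; _≤_; _<_; _<ᵇ_; _⊔_; _⊓_)
open import Data.Fin using (Fin; toℕ)
open import Data.List using (List; []; _∷_; length; take; drop; reverse; map; concatMap; tabulate)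
open import Data.Sum using (_⊎_; inj₁; inj₂)
open import Data.Product using (_×_; _,_; ∃)
open import Data.Bool using (if_then_else_)
open import Relation.Binary.PropositionalEquality using (_≡_; _≢_)
open import Relation.Nullary using (¬_)
open import Relation.Binary.Construct.Closure.ReflexiveTransitive using (Star)

-- The standing data of the setting.  Γ₀ = Fin nΓ (finite alphabet with
-- involution ιΓ, fixed points allowed), Ω₀ = Fin nΩ (variables with
-- fixed-point-free involution ιΩ).  Indices i ∈ {1..d} are 0-based: Fin d.
record Setup : Set where
  field
    nΓ nΩ d g : ℕ
    ιΓ       : Fin nΓ → Fin nΓ
    ιΓ-invol : ∀ a → ιΓ (ιΓ a) ≡ a
    ιΩ       : Fin nΩ → Fin nΩ
    ιΩ-invol : ∀ X → ιΩ (ιΩ X) ≡ X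
    ιΩ-nofix : ∀ X → ιΩ X ≢ X
    x        : Fin d → Fin nΓ ⊎ Fin nΩ
    2≤g      : 2 ≤ g
    g<d      : g < d
    σ        : Fin nΩ → List (Fin nΓ)
    -- σ(X̄) = overline(σ X), where overline(a₁⋯aₖ) = āₖ⋯ā₁
    σ-inv    : ∀ X → σ (ιΩ X) ≡ reverse (map ιΓ (σ X))

module _ (S : Setup) where
  open Setup S

  Sym : Set
  Sym = Fin nΓ ⊎ Fin nΩ

  invSym : Sym → Sym
  invSym (inj₁ a) = inj₁ (ιΓ a)
  invSym (inj₂ X) = inj₂ (ιΩ X)

  σ̂ : Sym → List (Fin nΓ)
  σ̂ (inj₁ a) = a ∷ []
  σ̂ (inj₂ X) = σ X

  σ* : List Sym → List (Fin nΓ)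
  σ* = concatMap σ̂

  xs : List Sym
  xs = tabulate x

  lhsSyms rhsSyms : List Sym
  lhsSyms = take g xs
  rhsSyms = drop g xs

  Solution : Set
  Solution = (σ* lhsSyms ≡ σ* rhsSyms) × (∀ i → σ̂ (x i) ≢ [])

  w₀ : List (Fin nΓ)
  w₀ = σ* lhsSyms

  m₀ : ℕ
  m₀ = length w₀

  len : Fin d → ℕ
  len i = length (σ̂ (x i))

  -- l(i) and r(i) (with 0-based i: toℕ i < g means 1 ≤ i+1 ≤ g)
  lft : Fin d → ℕ
  lft i = if toℕ i <ᵇ g
          then length (σ* (take (toℕ i) xs))
          else length (σ* (take (toℕ i ∸ g) rhsSyms))

  rgt : Fin d → ℕ
  rgt i = lft i + len i

  Interval : Set
  Interval = ℕ × ℕ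

  IsCut : ℕ → Set
  IsCut γ = ∃ λ i → (γ ≡ lft i) ⊎ (γ ≡ rgt i)

  data _∼_ : Interval → Interval → Set where
    same : ∀ i j μ ν → x i ≡ x j → μ ≤ len i → ν ≤ len i →
           (lft i + μ , lft i + ν) ∼ (lft j + μ , lft j + ν)
    flip : ∀ i j μ ν → x i ≡ invSym (x j) → μ ≤ len i → ν ≤ len i →
           (lft i + μ , lft i + ν) ∼ (rgt j ∸ μ , rgt j ∸ ν)

  _≈_ : Interval → Interval → Set
  _≈_ = Star _∼_

  Free : Interval → Set
  Free (α , β) = ∀ α' β' → (α' , β') ≈ (α , β) →
                 ∀ γ → IsCut γ → ¬ ((α' ⊓ β' < γ) × (γ < α' ⊔ β'))

{-# OPTIONS --safe #-}
-- Write [α,β'] = [α,β] ∪ [α',β'], two free pieces overlapping in [α',β].  A step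
-- of ∼ is a translation or a reflection of a whole segment σ(x_i), so it carries
-- such an overlapping decomposition of one interval to one of the other.  Hence
-- every interval ≈ [α,β'] is a union of two overlapping intervals, ≈ [α,β] and
-- ≈ [α',β'] respectively, and a cut strictly inside it would lie strictly inside
-- one of them.
module Submission where

open import Defs
open import Data.Nat using (ℕ; _≤_; _<_; _+_; _∸_; _⊓_; _⊔_; _<?_)
open import Data.Nat.Properties
open import Data.Product using (_,_; _×_; ∃₂; proj₁; proj₂)
open import Data.Sum using (_⊎_; inj₁; inj₂)
import Data.Sum as Sum
open import Data.List using (length; reverse; map)
open import Data.List.Properties using (length-reverse; length-map)
open import Function using (_∘_; id)
open import Relation.Nullary using (¬_; yes; no)
open import Relation.Binary.PropositionalEquality
open import Relation.Binary.Construct.Closure.ReflexiveTransitive using (ε; _◅_)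

private variable
  p q a b μ ν γ A B L R : ℕ

Inside : ℕ → ℕ × ℕ → Set
Inside γ (p , q) = p ⊓ q < γ × γ < p ⊔ q

inside : p ≤ q → p < γ → γ < q → Inside γ (p , q)
inside p≤q p<γ γ<q =
  subst (_< _) (sym (m≤n⇒m⊓n≡m p≤q)) p<γ , subst (_ <_) (sym (m≤n⇒m⊔n≡n p≤q)) γ<q

inside⁻¹ : p ≤ q → Inside γ (p , q) → p < γ × γ < q
inside⁻¹ p≤q (p⊓q<γ , γ<p⊔q) =
  subst (_< _) (m≤n⇒m⊓n≡m p≤q) p⊓q<γ , subst (_ <_) (m≤n⇒m⊔n≡n p≤q) γ<p⊔q

Inside-swap : Inside γ (p , q) → Inside γ (q , p)
Inside-swap {p = p} {q = q} (p⊓q<γ , γ<p⊔q) =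
  subst (_< _) (⊓-comm p q) p⊓q<γ , subst (_ <_) (⊔-comm p q) γ<p⊔q

-- Overlap (p , a) (b , q): the intervals [p,a] and [b,q] overlap in more than a
-- point and together make up [p,q], both oriented like [p,q].
data Overlap : ℕ × ℕ → ℕ × ℕ → Set where
  ascending  : p ≤ b → b < a → a ≤ q → Overlap (p , a) (b , q)
  descending : q ≤ a → a < b → b ≤ p → Overlap (p , a) (b , q)

cover-ascending : p ≤ b → b < a → a ≤ q →
                  Inside γ (p , q) → Inside γ (p , a) ⊎ Inside γ (b , q)
cover-ascending {a = a} {γ = γ} p≤b b<a a≤q γ∈pq with γ <? a
... | yes γ<a = inj₁ (inside p≤a (proj₁ (inside⁻¹ p≤q γ∈pq)) γ<a)
  where p≤a = ≤-trans p≤b (<⇒≤ b<a)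
        p≤q = ≤-trans p≤a a≤q
... | no γ≮a = inj₂ (inside b≤q (<-≤-trans b<a (≮⇒≥ γ≮a)) (proj₂ (inside⁻¹ p≤q γ∈pq)))
  where b≤q = ≤-trans (<⇒≤ b<a) a≤q
        p≤q = ≤-trans p≤b b≤q

Overlap-covers : Overlap (p , a) (b , q) →
                 Inside γ (p , q) → Inside γ (p , a) ⊎ Inside γ (b , q)
Overlap-covers (ascending p≤b b<a a≤q) = cover-ascending p≤b b<a a≤q
Overlap-covers (descending q≤a a<b b≤p) =
  Sum.swap ∘ Sum.map Inside-swap Inside-swap ∘ cover-ascending q≤a a<b b≤p ∘ Inside-swap

Overlap-lowerBound : L ≤ p → L ≤ q → Overlap (p , a) (b , q) → L ≤ a × L ≤ b
Overlap-lowerBound L≤p _ (ascending p≤b b<a _) = ≤-trans L≤b (<⇒≤ b<a) , L≤b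
  where L≤b = ≤-trans L≤p p≤b
Overlap-lowerBound _ L≤q (descending q≤a a<b _) = L≤a , ≤-trans L≤a (<⇒≤ a<b)
  where L≤a = ≤-trans L≤q q≤a

Overlap-upperBound : p ≤ R → q ≤ R → Overlap (p , a) (b , q) → a ≤ R × b ≤ R
Overlap-upperBound _ q≤R (ascending _ b<a a≤q) = a≤R , ≤-trans (<⇒≤ b<a) a≤R
  where a≤R = ≤-trans a≤q q≤R
Overlap-upperBound p≤R _ (descending _ a<b b≤p) = ≤-trans (<⇒≤ a<b) b≤R , b≤R
  where b≤R = ≤-trans b≤p p≤R

Overlap-translate : ∀ L → Overlap (p , a) (b , q) → Overlap (L + p , L + a) (L + b , L + q)
Overlap-translate L (ascending p≤b b<a a≤q) =
  ascending (+-monoʳ-≤ L p≤b) (+-monoʳ-< L b<a) (+-monoʳ-≤ L a≤q)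
Overlap-translate L (descending q≤a a<b b≤p) =
  descending (+-monoʳ-≤ L q≤a) (+-monoʳ-< L a<b) (+-monoʳ-≤ L b≤p)

Overlap-cancel : ∀ L → Overlap (L + p , L + a) (L + b , L + q) → Overlap (p , a) (b , q)
Overlap-cancel L (ascending p≤b b<a a≤q) =
  ascending (+-cancelˡ-≤ L _ _ p≤b) (+-cancelˡ-< L _ _ b<a) (+-cancelˡ-≤ L _ _ a≤q)
Overlap-cancel L (descending q≤a a<b b≤p) =
  descending (+-cancelˡ-≤ L _ _ q≤a) (+-cancelˡ-< L _ _ a<b) (+-cancelˡ-≤ L _ _ b≤p)

Overlap-reflect : ∀ R → p ≤ R → q ≤ R →
                  Overlap (p , a) (b , q) → Overlap (R ∸ p , R ∸ a) (R ∸ b , R ∸ q)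
Overlap-reflect R p≤R q≤R o@(ascending p≤b b<a a≤q) =
  descending (∸-monoʳ-≤ R a≤q) (∸-monoʳ-< b<a (proj₁ (Overlap-upperBound p≤R q≤R o)))
             (∸-monoʳ-≤ R p≤b)
Overlap-reflect R p≤R q≤R o@(descending q≤a a<b b≤p) =
  ascending (∸-monoʳ-≤ R b≤p) (∸-monoʳ-< a<b (proj₂ (Overlap-upperBound p≤R q≤R o)))
            (∸-monoʳ-≤ R q≤a)

Overlap-preimage-translate : ∀ L → Overlap (L + μ , A) (B , L + ν) →
  ∃₂ λ a b → A ≡ L + a × B ≡ L + b × Overlap (μ , a) (b , ν)
Overlap-preimage-translate {μ = μ} {A = A} {B = B} {ν = ν} L o =
  A ∸ L , B ∸ L , A≡ , B≡ ,
  Overlap-cancel L (subst₂ (λ A B → Overlap (L + μ , A) (B , L + ν)) A≡ B≡ o)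
  where
  L≤A×L≤B = Overlap-lowerBound (m≤m+n L μ) (m≤m+n L ν) o
  A≡ = sym (m+[n∸m]≡n (proj₁ L≤A×L≤B))
  B≡ = sym (m+[n∸m]≡n (proj₂ L≤A×L≤B))

Overlap-preimage-reflect : ∀ R → μ ≤ R → ν ≤ R → Overlap (R ∸ μ , A) (B , R ∸ ν) →
  ∃₂ λ a b → A ≡ R ∸ a × B ≡ R ∸ b × Overlap (μ , a) (b , ν)
Overlap-preimage-reflect {μ = μ} {ν = ν} {A = A} {B = B} R μ≤R ν≤R o =
  R ∸ A , R ∸ B , sym (m∸[m∸n]≡n A≤R) , sym (m∸[m∸n]≡n B≤R) ,
  subst₂ (λ μ ν → Overlap (μ , R ∸ A) (R ∸ B , ν)) (m∸[m∸n]≡n μ≤R) (m∸[m∸n]≡n ν≤R)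
         (Overlap-reflect R (m∸n≤m R μ) (m∸n≤m R ν) o)
  where
  A≤R = proj₁ (Overlap-upperBound (m∸n≤m R μ) (m∸n≤m R ν) o)
  B≤R = proj₂ (Overlap-upperBound (m∸n≤m R μ) (m∸n≤m R ν) o)

module _ (S : Setup) where
  open Setup S

  private
    infix 4 _∼ˢ_ _≈ˢ_
    _∼ˢ_ _≈ˢ_ : Interval S → Interval S → Set
    _∼ˢ_ = _∼_ S
    _≈ˢ_ = _≈_ S

  length-σ̂-invSym : ∀ s → length (σ̂ S (invSym S s)) ≡ length (σ̂ S s)
  length-σ̂-invSym (inj₁ _) = refl
  length-σ̂-invSym (inj₂ X) = begin
    length (σ (ιΩ X))               ≡⟨ cong length (σ-inv X) ⟩
    length (reverse (map ιΓ (σ X))) ≡⟨ length-reverse (map ιΓ (σ X)) ⟩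
    length (map ιΓ (σ X))           ≡⟨ length-map ιΓ (σ X) ⟩
    length (σ X)                    ∎
    where open ≡-Reasoning

  len≤rgt-of-flip : ∀ {i j} → x i ≡ invSym S (x j) → len S i ≤ rgt S j
  len≤rgt-of-flip {i} {j} xi≡x̄j =
    subst (_≤ rgt S j) (sym len-i≡len-j) (m≤n+m (len S j) (lft S j))
    where
    len-i≡len-j : len S i ≡ len S j
    len-i≡len-j = trans (cong (length ∘ σ̂ S) xi≡x̄j) (length-σ̂-invSym (x j))

  Overlap-pullback : ∀ {P Q P′ Q′ A′ B′} → (P , Q) ∼ˢ (P′ , Q′) → Overlap (P′ , A′) (B′ , Q′) →
    ∃₂ λ A B → (P , A) ∼ˢ (P′ , A′) × (B , Q) ∼ˢ (B′ , Q′) × Overlap (P , A) (B , Q)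
  Overlap-pullback (same i j μ ν xi≡xj μ≤ ν≤) o′
    with Overlap-preimage-translate (lft S j) o′
  ... | a , b , refl , refl , o =
    lft S i + a , lft S i + b , same i j μ a xi≡xj μ≤ a≤ , same i j b ν xi≡xj b≤ ν≤ ,
    Overlap-translate (lft S i) o
    where a≤ = proj₁ (Overlap-upperBound μ≤ ν≤ o)
          b≤ = proj₂ (Overlap-upperBound μ≤ ν≤ o)
  Overlap-pullback (flip i j μ ν xi≡x̄j μ≤ ν≤) o′
    with Overlap-preimage-reflect (rgt S j) (≤-trans μ≤ (len≤rgt-of-flip xi≡x̄j))
                                   (≤-trans ν≤ (len≤rgt-of-flip xi≡x̄j)) o′
  ... | a , b , refl , refl , o =
    lft S i + a , lft S i + b , flip i j μ a xi≡x̄j μ≤ a≤ , flip i j b ν xi≡x̄j b≤ ν≤ ,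
    Overlap-translate (lft S i) o
    where a≤ = proj₁ (Overlap-upperBound μ≤ ν≤ o)
          b≤ = proj₂ (Overlap-upperBound μ≤ ν≤ o)

  data Splits (I J : Interval S) : Interval S → Set where
    splits : ∀ {P A B Q} → (P , A) ≈ˢ I → (B , Q) ≈ˢ J → Overlap (P , A) (B , Q) →
             Splits I J (P , Q)

  Splits-pullback : ∀ {I J K K′} → K ∼ˢ K′ → Splits I J K′ → Splits I J K
  Splits-pullback K∼K′ (splits PA≈I BQ≈J o′) with Overlap-pullback K∼K′ o′
  ... | _ , _ , PA∼ , BQ∼ , o = splits (PA∼ ◅ PA≈I) (BQ∼ ◅ BQ≈J) o

  Splits-≈ : ∀ {I J K K′} → K ≈ˢ K′ → Splits I J K′ → Splits I J K
  Splits-≈ ε              = id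
  Splits-≈ (K∼K″ ◅ K″≈K′) = Splits-pullback K∼K″ ∘ Splits-≈ K″≈K′

  CutFree : Interval S → Set
  CutFree K = ∀ γ → IsCut S γ → ¬ Inside γ K

  Splits-cutFree : ∀ {I J K} → Free S I → Free S J → Splits I J K → CutFree K
  Splits-cutFree freeI freeJ (splits {P} {A} {B} {Q} PA≈I BQ≈J o) γ cut γ∈PQ
    with Overlap-covers o γ∈PQ
  ... | inj₁ γ∈PA = freeI P A PA≈I γ cut γ∈PA
  ... | inj₂ γ∈BQ = freeJ B Q BQ≈J γ cut γ∈BQ

lemma11 : (S : Setup) → Solution S →
    ∀ (α α' β β' : ℕ) → α ≤ α' → α' < β → β ≤ β' → β' ≤ m₀ S →
    Free S (α , β) → Free S (α' , β') → Free S (α , β')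
lemma11 S _ α α' β β' α≤α' α'<β β≤β' _ free free' P Q PQ≈αβ' =
  Splits-cutFree S free free' (Splits-≈ S PQ≈αβ' αβ'-splits)
  where
  αβ'-splits : Splits S (α , β) (α' , β') (α , β')
  αβ'-splits = splits ε ε (ascending α≤α' α'<β β≤β')
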